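{- If $2k+1>3$ is a non-rank, then there exist a prime $p\geq 5$ and an integer $n$ such that either $n\geq 0$ and $2k+1=(2n+1)p+4N(p/6)$, or $n\geq 1$ and $2k+1=(2n+1)p-4N(p/6)$.
   Context: For real $x$, $N(x)$ denotes the integer nearest to $x$. An odd integer $t\geq 3$ is a non-rank if $3t-2$ and $3t+2$ are not both prime. -}

module Defs where

open import Data.Nat using (ℕ; _+_; _*_; _∸_; _/_; _≤_)
open import Data.Nat.Primality using (Prime)
open import Data.Product using (_×_)
open import Relation.Nullary using (¬_)
open import Data.Product using (∃-syntax)
open import Relation.Binary.PropositionalEquality using (_≡_)

Odd : ℕ → Set
Odd t = ∃[ m ] t ≡ 2 * m + 1

-- N(m/6): the integer nearest to m/6, for m : ℕ, computed as ⌊(m+3)/6⌋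
-- (ties, i.e. m ≡ 3 mod 6, round up; ties never occur for primes p ≥ 5).
N/6 : ℕ → ℕ
N/6 m = (m + 3) / 6

NonRank : ℕ → Set
NonRank t = Odd t × 3 ≤ t × ¬ (Prime (3 * t ∸ 2) × Prime (3 * t + 2))

{-# OPTIONS --safe #-}
-- Put t = 2k+1. As t is a non-rank, one of its neighbours x = 3t ∓ 2, i.e. 6k+1 or 6k+5, is
-- composite: x = q p with p prime and q > 1. Since x is prime to 6, both p and q are ≡ ±1 mod 6.
-- As 12 N(p/6) = 2p ∓ 2 for p ≡ ±1 mod 6, writing q = 6n+1 or q = 6n+5 gives q p = 3s ∓ 2 with
-- s = (2n+1) p ∓ 4 N(p/6); and s = t because 3 ∤ 4, so x determines t in x = 3t ∓ 2.
module Submission where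

open import Defs
open import Data.List using ([]; _∷_)
open import Data.Nat using (ℕ; zero; suc; _+_; _*_; _∸_; _/_; _≤_; _<_; _<?_; z≤n; s≤s; z<s; s<s; NonZero; >-nonZero)
open import Data.Nat.DivMod using (result; _divMod_; +-distrib-/-∣ʳ; m<n⇒m/n≡0; m*n/n≡m)
open import Data.Nat.Divisibility using (_∣_; _∣?_; divides; n∣m*n; ∣-trans; ∣m∣n⇒∣m+n; ∣m+n∣m⇒∣n)
open import Data.Nat.ListAction using (product)
open import Data.Nat.Primality using (Prime; prime?; ¬prime[1])
open import Data.Nat.Primality.Factorisation using (factorise)
open import Data.Nat.Properties
open import Data.Nat.Tactic.RingSolver using (solve)
open import Data.Fin using (zero; suc)
import Data.List.Relation.Unary.All as All
open import Data.Product using (_×_; ∃-syntax; _,_)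
open import Data.Sum using (_⊎_; inj₁; inj₂)
open import Relation.Nullary using (¬_; Dec; yes; no; contradiction)
open import Relation.Nullary.Decidable using (from-yes; from-no)
open import Relation.Binary.PropositionalEquality

data _≡±1[mod6] : ℕ → Set where
  ≡+1 : ∀ a → (1 + a * 6) ≡±1[mod6]
  ≡-1 : ∀ a → (5 + a * 6) ≡±1[mod6]

private
  variable
    d n r s t x : ℕ

∣r⇒∣r+a*n : ∀ a → d ∣ n → d ∣ r → d ∣ r + a * n
∣r⇒∣r+a*n a d∣n d∣r = ∣m∣n⇒∣m+n d∣r (∣-trans d∣n (n∣m*n a))

∣r+a*n⇒∣r : ∀ a → d ∣ n → d ∣ r + a * n → d ∣ r
∣r+a*n⇒∣r {d} {r = r} a d∣n d∣r+a*n = ∣m+n∣m⇒∣n (subst (d ∣_) (+-comm r (a * _)) d∣r+a*n) (∣-trans d∣n (n∣m*n a))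

[r+a*n]/n≡a : ∀ {n} a .{{_ : NonZero n}} → r < n → (r + a * n) / n ≡ a
[r+a*n]/n≡a {r} {n} a r<n = begin
  (r + a * n) / n      ≡⟨ +-distrib-/-∣ʳ r (n∣m*n a) ⟩
  r / n + a * n / n    ≡⟨ cong₂ _+_ (m<n⇒m/n≡0 r<n) (m*n/n≡m a n) ⟩
  a                    ∎
  where open ≡-Reasoning

≡±1[mod6]-classify : ¬ 2 ∣ x → ¬ 3 ∣ x → x ≡±1[mod6]
≡±1[mod6]-classify {x} 2∤x 3∤x with x divMod 6
... | result a zero                               refl = contradiction (∣r⇒∣r+a*n a (divides 3 refl) (divides 0 refl)) 2∤x
... | result a (suc zero)                         refl = ≡+1 a
... | result a (suc (suc zero))                   refl = contradiction (∣r⇒∣r+a*n a (divides 3 refl) (divides 1 refl)) 2∤x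
... | result a (suc (suc (suc zero)))             refl = contradiction (∣r⇒∣r+a*n a (divides 2 refl) (divides 1 refl)) 3∤x
... | result a (suc (suc (suc (suc zero))))       refl = contradiction (∣r⇒∣r+a*n a (divides 3 refl) (divides 2 refl)) 2∤x
... | result a (suc (suc (suc (suc (suc zero))))) refl = ≡-1 a

≡±1[mod6]⇒2∤ : x ≡±1[mod6] → ¬ 2 ∣ x
≡±1[mod6]⇒2∤ (≡+1 a) 2∣x = from-no (2 ∣? 1) (∣r+a*n⇒∣r a (divides 3 refl) 2∣x)
≡±1[mod6]⇒2∤ (≡-1 a) 2∣x = from-no (2 ∣? 5) (∣r+a*n⇒∣r a (divides 3 refl) 2∣x)

≡±1[mod6]⇒3∤ : x ≡±1[mod6] → ¬ 3 ∣ x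
≡±1[mod6]⇒3∤ (≡+1 a) 3∣x = from-no (3 ∣? 1) (∣r+a*n⇒∣r a (divides 2 refl) 3∣x)
≡±1[mod6]⇒3∤ (≡-1 a) 3∣x = from-no (3 ∣? 5) (∣r+a*n⇒∣r a (divides 2 refl) 3∣x)

≡±1[mod6]-∣ : d ∣ x → x ≡±1[mod6] → d ≡±1[mod6]
≡±1[mod6]-∣ d∣x x≡±1 = ≡±1[mod6]-classify
  (λ 2∣d → ≡±1[mod6]⇒2∤ x≡±1 (∣-trans 2∣d d∣x))
  (λ 3∣d → ≡±1[mod6]⇒3∤ x≡±1 (∣-trans 3∣d d∣x))

prime-≡±1[mod6]⇒≥5 : Prime x → x ≡±1[mod6] → 5 ≤ x
prime-≡±1[mod6]⇒≥5 P (≡+1 zero)    = contradiction P ¬prime[1]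
prime-≡±1[mod6]⇒≥5 P (≡+1 (suc a)) = m≤m+n 5 (2 + a * 6)
prime-≡±1[mod6]⇒≥5 P (≡-1 a)       = m≤m+n 5 (a * 6)

N/6[1+a*6]≡a : ∀ a → N/6 (1 + a * 6) ≡ a
N/6[1+a*6]≡a a = trans (cong (_/ 6) (+-comm (1 + a * 6) 3)) ([r+a*n]/n≡a a (from-yes (4 <? 6)))

N/6[5+a*6]≡1+a : ∀ a → N/6 (5 + a * 6) ≡ suc a
N/6[5+a*6]≡1+a a = trans (cong (_/ 6) (+-comm (5 + a * 6) 3)) ([r+a*n]/n≡a (suc a) (from-yes (2 <? 6)))

infix 4 _≡3*_∓2
_≡3*_∓2 : ℕ → ℕ → Set
x ≡3* s ∓2 = x + 2 ≡ 3 * s ⊎ x ≡ 3 * s + 2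

3*s+4≢3*t : ∀ s t → 3 * s + 4 ≢ 3 * t
3*s+4≢3*t s t eq = from-no (3 ∣? 4) (∣m+n∣m⇒∣n (divides t (trans eq (*-comm 3 t))) (divides s (*-comm 3 s)))

≡3*∓2-injective : x ≡3* s ∓2 → x ≡3* t ∓2 → s ≡ t
≡3*∓2-injective {s = s} {t} (inj₁ x+2≡3s) (inj₁ x+2≡3t) = *-cancelˡ-≡ s t 3 (trans (sym x+2≡3s) x+2≡3t)
≡3*∓2-injective {s = s} {t} (inj₂ x≡3s+2) (inj₂ x≡3t+2) = *-cancelˡ-≡ s t 3 (+-cancelʳ-≡ 2 _ _ (trans (sym x≡3s+2) x≡3t+2))
≡3*∓2-injective {x} {s} {t} (inj₁ x+2≡3s) (inj₂ x≡3t+2) = contradiction (begin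
  3 * t + 4     ≡⟨ +-assoc (3 * t) 2 2 ⟨
  3 * t + 2 + 2 ≡⟨ cong (_+ 2) x≡3t+2 ⟨
  x + 2         ≡⟨ x+2≡3s ⟩
  3 * s         ∎) (3*s+4≢3*t t s)
  where open ≡-Reasoning
≡3*∓2-injective (inj₂ x≡3s+2) (inj₁ x+2≡3t) = sym (≡3*∓2-injective (inj₁ x+2≡3t) (inj₂ x≡3s+2))

Representation : ℕ → ℕ → ℕ → Set
Representation t p n =
  t ≡ (2 * n + 1) * p + 4 * N/6 p ⊎ (1 ≤ n × t + 4 * N/6 p ≡ (2 * n + 1) * p)

1<1+n*m⇒1≤n : ∀ n m → 1 < 1 + n * m → 1 ≤ n
1<1+n*m⇒1≤n zero    m (s≤s ())
1<1+n*m⇒1≤n (suc n) m _ = s≤s z≤n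

product-representation : ∀ {p q} → p ≡±1[mod6] → q ≡±1[mod6] → 1 < q →
  ∃[ s ] ∃[ n ] (q * p ≡3* s ∓2 × Representation s p n)
product-representation (≡+1 a) (≡+1 n) 1<q =
  1 + 2 * n + 2 * a + 12 * n * a , n ,
  inj₁ (solve (n ∷ a ∷ [])) ,
  inj₂ (1<1+n*m⇒1≤n n 6 1<q ,
        trans (cong (λ m → 1 + 2 * n + 2 * a + 12 * n * a + 4 * m) (N/6[1+a*6]≡a a)) (solve (n ∷ a ∷ [])))
product-representation (≡+1 a) (≡-1 n) _ =
  1 + 2 * n + 10 * a + 12 * n * a , n ,
  inj₂ (solve (n ∷ a ∷ [])) ,
  inj₁ (sym (trans (cong (λ m → (2 * n + 1) * (1 + a * 6) + 4 * m) (N/6[1+a*6]≡a a)) (solve (n ∷ a ∷ []))))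
product-representation (≡-1 a) (≡+1 n) 1<q =
  1 + 10 * n + 2 * a + 12 * n * a , n ,
  inj₂ (solve (n ∷ a ∷ [])) ,
  inj₂ (1<1+n*m⇒1≤n n 6 1<q ,
        trans (cong (λ m → 1 + 10 * n + 2 * a + 12 * n * a + 4 * m) (N/6[5+a*6]≡1+a a)) (solve (n ∷ a ∷ [])))
product-representation (≡-1 a) (≡-1 n) _ =
  9 + 10 * n + 10 * a + 12 * n * a , n ,
  inj₁ (solve (n ∷ a ∷ [])) ,
  inj₁ (sym (trans (cong (λ m → (2 * n + 1) * (5 + a * 6) + 4 * m) (N/6[5+a*6]≡1+a a)) (solve (n ∷ a ∷ []))))

¬prime⇒prime*cofactor : 1 < x → ¬ Prime x → ∃[ p ] ∃[ q ] (Prime p × 1 < q × x ≡ q * p)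
¬prime⇒prime*cofactor {x} 1<x ¬P with factorise x {{>-nonZero (<-trans z<s 1<x)}}
... | record { factors = [] ; isFactorisation = x≡1 } = contradiction x≡1 (>⇒≢ 1<x)
... | record { factors = p ∷ ps ; isFactorisation = x≡p*q ; factorsPrime = P All.∷ _ } =
  p , product ps , P , 1<cofactor (product ps) x≡p*q , trans x≡p*q (*-comm p _)
  where
  1<cofactor : ∀ q → x ≡ p * q → 1 < q
  1<cofactor zero          x≡p*0 = contradiction (trans x≡p*0 (*-zeroʳ p)) (>⇒≢ (<-trans z<s 1<x))
  1<cofactor (suc zero)    x≡p*1 = contradiction (subst Prime (sym (trans x≡p*1 (*-identityʳ p))) P) ¬P
  1<cofactor (suc (suc q)) _     = s<s z<s

nonRank⇒¬prime-neighbour : ∀ k → NonRank (2 * k + 1) →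
  ∃[ x ] (x ≡3* 2 * k + 1 ∓2 × x ≡±1[mod6] × 1 < x × ¬ Prime x)
nonRank⇒¬prime-neighbour k (_ , 3≤t , ¬both) = neighbour (prime? (5 + k * 6))
  where
  6k+1+2≡3t : 1 + k * 6 + 2 ≡ 3 * (2 * k + 1)
  6k+1+2≡3t = solve (k ∷ [])
  6k+5≡3t+2 : 5 + k * 6 ≡ 3 * (2 * k + 1) + 2
  6k+5≡3t+2 = solve (k ∷ [])
  1<6k+1 : ∀ k → 3 ≤ 2 * k + 1 → 1 < 1 + k * 6
  1<6k+1 zero    (s≤s ())
  1<6k+1 (suc k) _ = s<s z<s
  neighbour : Dec (Prime (5 + k * 6)) → ∃[ x ] (x ≡3* 2 * k + 1 ∓2 × x ≡±1[mod6] × 1 < x × ¬ Prime x)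
  neighbour (yes P₊) = 1 + k * 6 , inj₁ 6k+1+2≡3t , ≡+1 k , 1<6k+1 k 3≤t ,
    λ P₋ → ¬both (subst Prime (sym (trans (cong (_∸ 2) (sym 6k+1+2≡3t)) (m+n∸n≡m _ 2))) P₋ ,
                  subst Prime 6k+5≡3t+2 P₊)
  neighbour (no ¬P₊) = 5 + k * 6 , inj₂ 6k+5≡3t+2 , ≡-1 k , s<s z<s , ¬P₊

lemma2p6 : (k : ℕ) → 3 < 2 * k + 1 → NonRank (2 * k + 1) →
    ∃[ p ] ∃[ n ] (Prime p × 5 ≤ p ×
      ((2 * k + 1 ≡ (2 * n + 1) * p + 4 * N/6 p)
       ⊎ (1 ≤ n × 2 * k + 1 + 4 * N/6 p ≡ (2 * n + 1) * p)))
-- The hypothesis 3 < t is redundant: the bound 3 ≤ t contained in NonRank suffices.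
lemma2p6 k _ nonRank =
  let x , x≡3t∓2 , x≡±1 , 1<x , ¬P = nonRank⇒¬prime-neighbour k nonRank
      p , q , P , 1<q , x≡qp       = ¬prime⇒prime*cofactor 1<x ¬P
      p≡±1                         = ≡±1[mod6]-∣ (divides q x≡qp) x≡±1
      q≡±1                         = ≡±1[mod6]-∣ (divides p (trans x≡qp (*-comm q p))) x≡±1
      s , n , qp≡3s∓2 , rep        = product-representation p≡±1 q≡±1 1<q
      s≡t = ≡3*∓2-injective (subst (_≡3* s ∓2) (sym x≡qp) qp≡3s∓2) x≡3t∓2
  in p , n , P , prime-≡±1[mod6]⇒≥5 P p≡±1 , subst (λ t → Representation t p n) s≡t rep
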